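{- Let $\mathcal{M}$ be a regular $n$-maniplex and $\omega\colon E(\mathcal{M})\to\mathbb{Z}_k$ a weight function. If $(\mathcal{M},\omega)$ is a proper pair and $k=4$, then $\mathcal{M}^\omega$ is an unstable $2$-orbit maniplex.
   Context: An $n$-maniplex is a connected $n$-valent simple graph with a proper edge-colouring by $\{0,\dots,n-1\}$ such that whenever $|i-j|>1$ the edges of colours $i,j$ form a disjoint union of $4$-cycles; vertices are flags, $u^i$ is the $i$-neighbour of $u$; automorphisms are colour-preserving graph automorphisms; a $k$-orbit maniplex has exactly $k$ flag-orbits under its automorphism group; regular means $1$-orbit; non-orientable means non-bipartite. The canonical double cover of a non-orientable maniplex with flag set $\mathcal{F}$ has flags $\mathcal{F}\times\mathbb{Z}_2$ and $(u,j)^i=(u^i,j+1)$; its expected automorphisms are $(u,j)\mapsto(u\varphi,j+a)$ for $\varphi\in\mathrm{Aut}(\mathcal{M})$, $a\in\mathbb{Z}_2$; the maniplex is unstable if the double cover has an automorphism that is not expected. For a weight $\omega\colon E(\Gamma)\to\mathbb{Z}_k$, the cross-cover $\Gamma^\omega$ has vertex set $V(\Gamma)\times\mathbb{Z}_k$ with $(u,i)$ adjacent to $(v,\omega(e)-i)$ for each edge $e=uv$, the new edge receiving the colour of $e$; $\pi(u,i)=u$. For a walk $W=(u_0,\dots,u_m)$ with edges $e_j$, $\omega(W)=\sum_j(-1)^j\omega(e_j)$. An automorphism $\varphi$ of $\mathcal{M}$ lifts if there is an automorphism $\bar\varphi$ of $\mathcal{M}^\omega$ with $\pi(y\bar\varphi)=\pi(y)\varphi$;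 $\omega$ is $\mathrm{Aut}(\mathcal{M})$-consistent if every automorphism lifts. $(\mathcal{M},\omega)$ is a proper pair if (1) $\mathcal{M}$ is regular, (2) $\mathcal{M}$ has a closed walk $W$ of odd length with $\omega(W)$ even, (3) $\mathcal{M}^\omega$ is a non-orientable maniplex, (4) $\omega$ is $\mathrm{Aut}(\mathcal{M})$-consistent. -}

module Defs where

open import Data.Nat using (ℕ; zero; suc; _+_; _∸_; _<_; ∣_-_∣; _%_)
open import Data.Nat.DivMod using (_mod_)
open import Data.Fin using (Fin; toℕ) renaming (zero to fzero)
open import Data.Bool using (Bool; not; _xor_)
open import Data.List using (List; []; _∷_; length)
open import Data.Product using (Σ; ∃; _×_; _,_; proj₁; proj₂)
open import Data.Sum using (_⊎_)
open import Relation.Nullary using (¬_)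
open import Relation.Binary.PropositionalEquality using (_≡_; _≢_)

-- ℤ_k, represented as Fin (suc k)

_⊖_ : ∀ {k} → Fin (suc k) → Fin (suc k) → Fin (suc k)
_⊖_ {k} a b = (toℕ a + (suc k ∸ toℕ b)) mod (suc k)

-- parity of an element of ℤ_k (meaningful for even k; used with k = 4)
EvenZ : ∀ {k} → Fin (suc k) → Set
EvenZ a = toℕ a % 2 ≡ 0

-- An n-edge-coloured graph in which every vertex has exactly one edge of
-- each colour: flags plus, for each colour i, the i-neighbour map u ↦ u^i.

record PreManiplex (n : ℕ) : Set₁ where
  field
    Flag : Set
    r    : Fin n → Flag → Flag

open PreManiplex public

module _ {n : ℕ} (M : PreManiplex n) where

  walkEnd : Flag M → List (Fin n) → Flag M
  walkEnd u []       = u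
  walkEnd u (c ∷ cs) = walkEnd (r M c u) cs

  record IsManiplex : Set where
    field
      involution : ∀ i u → r M i (r M i u) ≡ u
      noLoop     : ∀ i u → r M i u ≢ u
      noMulti    : ∀ i j u → i ≢ j → r M i u ≢ r M j u
      fourCycles : ∀ i j u → 1 < ∣ toℕ i - toℕ j ∣ →
                   r M i (r M j u) ≡ r M j (r M i u)
      connected  : ∀ u v → ∃ λ (cs : List (Fin n)) → walkEnd u cs ≡ v

  Orientable : Set
  Orientable = Σ (Flag M → Bool) λ c → ∀ i u → c (r M i u) ≡ not (c u)

  NonOrientable : Set
  NonOrientable = ¬ Orientable

  -- colour-preserving graph automorphisms (written on the right: uφ = to φ u)
  record Aut : Set where
    field
      to       : Flag M → Flag M
      from     : Flag M → Flag M
      to-from  : ∀ u → to (from u) ≡ u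
      from-to  : ∀ u → from (to u) ≡ u
      preserve : ∀ i u → to (r M i u) ≡ r M i (to u)

  open Aut public

  SameOrbit : Flag M → Flag M → Set
  SameOrbit u v = Σ Aut λ φ → to φ u ≡ v

  Regular : Set
  Regular = Σ (Flag M) λ u → ∀ x → SameOrbit u x

  TwoOrbit : Set
  TwoOrbit = Σ (Flag M) λ u → Σ (Flag M) λ v →
             ¬ SameOrbit u v × (∀ x → SameOrbit u x ⊎ SameOrbit v x)

  doubleCover : PreManiplex n
  doubleCover = record
    { Flag = Flag M × Bool
    ; r    = λ i y → r M i (proj₁ y) , not (proj₂ y) }

module _ {n : ℕ} (M : PreManiplex n) where

  Expected : Aut (doubleCover M) → Set
  Expected ψ = Σ (Aut M) λ φ → Σ Bool λ a →
               ∀ u j → to ψ (u , j) ≡ (to φ u , j xor a)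

  Unstable : Set
  Unstable = Σ (Aut (doubleCover M)) λ ψ → ¬ Expected ψ

module _ {n k : ℕ} (M : PreManiplex n) where

  -- a weight on edges: the edge {u, u^i} gets w i u, well defined
  IsWeight : (Fin n → Flag M → Fin (suc k)) → Set
  IsWeight w = ∀ i u → w i (r M i u) ≡ w i u

  crossCover : (Fin n → Flag M → Fin (suc k)) → PreManiplex n
  crossCover w = record
    { Flag = Flag M × Fin (suc k)
    ; r    = λ i y → r M i (proj₁ y) , (w i (proj₁ y) ⊖ proj₂ y) }

  -- alternating weight ω(W) = Σ_j (-1)^j ω(e_j) of the walk from u along cs
  walkWeight : (Fin n → Flag M → Fin (suc k)) → Flag M → List (Fin n) → Fin (suc k)
  walkWeight w u []       = fzero
  walkWeight w u (c ∷ cs) = w c u ⊖ walkWeight w (r M c u) cs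

  Lifts : (w : Fin n → Flag M → Fin (suc k)) → Aut M → Set
  Lifts w φ = Σ (Aut (crossCover w)) λ ψ →
              ∀ y → proj₁ (to ψ y) ≡ to φ (proj₁ y)

  Consistent : (Fin n → Flag M → Fin (suc k)) → Set
  Consistent w = ∀ φ → Lifts w φ

  ProperPair : (Fin n → Flag M → Fin (suc k)) → Set
  ProperPair w =
      Regular M
    × (Σ (Flag M) λ u → Σ (List (Fin n)) λ cs →
         walkEnd M u cs ≡ u × length cs % 2 ≡ 1 × EvenZ (walkWeight w u cs))
    × (IsManiplex (crossCover w) × NonOrientable (crossCover w))
    × Consistent w

{-# OPTIONS --safe #-}
module Submission where

-- Lifting a closed walk of odd length at u from the flag (u , a) of the
-- cross-cover ends at (u , ω - a), where ω is the weight of the walk; so every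
-- automorphism commutes with this reflection of the fibre over u. For even ω
-- the reflection fixes exactly one of 0 and 1, hence (u , 0) and (u , 1) lie in
-- different orbits. By regularity and consistency every flag is in the orbit of
-- a flag over u, and the half-turn a ↦ a + 2 is an automorphism, so there are
-- exactly two orbits. On the double cover, shifting fibres by +1 on one sheet and
-- by -1 on the other is an automorphism, whereas an expected automorphism acts
-- in the same way on both sheets.

open import Defs
open import Data.Fin using (Fin; #_) renaming (zero to fzero; suc to fsuc)
open import Data.Fin.Properties using (all?; _≟_)
open import Data.Nat using (ℕ; zero; suc; _%_; parity)
open import Data.Parity using (Parity; 0ℙ; 1ℙ; _⁻¹)
open import Data.Parity.Properties using (suc-homo-⁻¹; ⁻¹-selfInverse)
open import Data.Bool using (Bool; true; false; not)
open import Data.List using (List; []; _∷_; length)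
open import Data.Product using (∃; _×_; _,_; proj₁; proj₂)
open import Data.Sum using (_⊎_; inj₁; inj₂) renaming (map to ⊎-map)
open import Function.Bundles using (_⇔_; mk⇔; module Equivalence)
open import Relation.Nullary using (¬_)
open import Relation.Nullary.Decidable using (from-yes)
open import Relation.Binary.PropositionalEquality
  using (_≡_; _≢_; refl; sym; trans; cong; cong₂; module ≡-Reasoning)

module _ {n : ℕ} {M : PreManiplex n} where

  idAut : Aut M
  idAut = record
    { to = λ x → x ; from = λ x → x
    ; to-from = λ _ → refl ; from-to = λ _ → refl ; preserve = λ _ _ → refl }

  infixl 5 _⨾_
  _⨾_ : Aut M → Aut M → Aut M
  φ ⨾ ψ = record
    { to       = λ x → to ψ (to φ x)
    ; from     = λ x → from φ (from ψ x)
    ; to-from  = λ x → trans (cong (to ψ) (to-from φ (from ψ x))) (to-from ψ x)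
    ; from-to  = λ x → trans (cong (from φ) (from-to ψ (to φ x))) (from-to φ x)
    ; preserve = λ i x → trans (cong (to ψ) (preserve φ i x)) (preserve ψ i (to φ x)) }

  to-injective : (φ : Aut M) {x y : Flag M} → to φ x ≡ to φ y → x ≡ y
  to-injective φ {x} {y} eq = begin
    x                 ≡⟨ sym (from-to φ x) ⟩
    from φ (to φ x)   ≡⟨ cong (from φ) eq ⟩
    from φ (to φ y)   ≡⟨ from-to φ y ⟩
    y                 ∎
    where open ≡-Reasoning

  infix 8 _⁻¹ᴬ
  _⁻¹ᴬ : Aut M → Aut M
  φ ⁻¹ᴬ = record
    { to = from φ ; from = to φ ; to-from = from-to φ ; from-to = to-from φ
    ; preserve = λ i x → to-injective φ (begin
        to φ (from φ (r M i x))   ≡⟨ to-from φ (r M i x) ⟩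
        r M i x                   ≡⟨ cong (r M i) (sym (to-from φ x)) ⟩
        r M i (to φ (from φ x))   ≡⟨ sym (preserve φ i (from φ x)) ⟩
        to φ (r M i (from φ x))   ∎) }
    where open ≡-Reasoning

  to-walkEnd : (φ : Aut M) (x : Flag M) (cs : List (Fin n)) →
               to φ (walkEnd M x cs) ≡ walkEnd M (to φ x) cs
  to-walkEnd φ x []       = refl
  to-walkEnd φ x (c ∷ cs) =
    trans (to-walkEnd φ (r M c x) cs) (cong (λ z → walkEnd M z cs) (preserve φ c x))

  SameOrbit-refl : (x : Flag M) → SameOrbit M x x
  SameOrbit-refl x = idAut , refl

  SameOrbit-sym : {x y : Flag M} → SameOrbit M x y → SameOrbit M y x
  SameOrbit-sym (φ , eq) = φ ⁻¹ᴬ , to-injective φ (trans (to-from φ _) (sym eq))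

  SameOrbit-trans : {x y z : Flag M} → SameOrbit M x y → SameOrbit M y z → SameOrbit M x z
  SameOrbit-trans (φ , eq) (ψ , eq′) = φ ⨾ ψ , trans (cong (to ψ) eq) eq′

  Regular⇒SameOrbit : Regular M → (x y : Flag M) → SameOrbit M x y
  Regular⇒SameOrbit (_ , reach) x y = SameOrbit-trans (SameOrbit-sym (reach x)) (reach y)

Expected⇒sheet-independent : {n : ℕ} (M : PreManiplex n) (ψ : Aut (doubleCover M)) →
  Expected M ψ → (x : Flag M) → proj₁ (to ψ (x , false)) ≡ proj₁ (to ψ (x , true))
Expected⇒sheet-independent M ψ (_ , _ , eq) x =
  trans (cong proj₁ (eq x false)) (sym (cong proj₁ (eq x true)))

module CrossCover {n k : ℕ} (M : PreManiplex n) (w : Fin n → Flag M → Fin (suc k)) where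

  W : PreManiplex n
  W = crossCover M w

  proj₁-walkEnd : (u : Flag M) (a : Fin (suc k)) (cs : List (Fin n)) →
                  proj₁ (walkEnd W (u , a) cs) ≡ walkEnd M u cs
  proj₁-walkEnd u a []       = refl
  proj₁-walkEnd u a (c ∷ cs) = proj₁-walkEnd (r M c u) (w c u ⊖ a) cs

  lift-reaches-fibre : (φ : Aut M) → Lifts M w φ → {u v : Flag M} → to φ u ≡ v →
                       (b : Fin (suc k)) → ∃ λ a → SameOrbit W (u , a) (v , b)
  lift-reaches-fibre φ (ψ , covers) {u} {v} φu≡v b = proj₂ y , ψ , trans (cong (to ψ) u,y₂≡y) ψy≡
    where
    y = from ψ (v , b)
    ψy≡ : to ψ y ≡ (v , b)
    ψy≡ = to-from ψ (v , b)
    y₁≡u : proj₁ y ≡ u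
    y₁≡u = to-injective φ (trans (sym (covers y)) (trans (cong proj₁ ψy≡) (sym φu≡v)))
    u,y₂≡y : (u , proj₂ y) ≡ y
    u,y₂≡y = cong (_, proj₂ y) (sym y₁≡u)

  orbit-meets-fibre : Regular M → Consistent M w → (u : Flag M) (x : Flag W) →
                      ∃ λ a → SameOrbit W (u , a) x
  orbit-meets-fibre reg consistent u (v , b) with Regular⇒SameOrbit reg u v
  ... | φ , φu≡v = lift-reaches-fibre φ (consistent φ) φu≡v b

ℤ₄ : Set
ℤ₄ = Fin 4

infix 25 -_
-_ : ℤ₄ → ℤ₄
- c = fzero ⊖ c

⊖-identityʳ : (a : ℤ₄) → a ⊖ fzero ≡ a
⊖-identityʳ = from-yes (all? λ (a : ℤ₄) → a ⊖ fzero ≟ a)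

⊖-rightComm : (x a b : ℤ₄) → (x ⊖ a) ⊖ b ≡ (x ⊖ b) ⊖ a
⊖-rightComm = from-yes (all? λ (x : ℤ₄) → all? λ (a : ℤ₄) → all? λ (b : ℤ₄) →
  (x ⊖ a) ⊖ b ≟ (x ⊖ b) ⊖ a)

⊖-⊖-exchange : (x a b : ℤ₄) → b ⊖ (x ⊖ a) ≡ a ⊖ (x ⊖ b)
⊖-⊖-exchange = from-yes (all? λ (x : ℤ₄) → all? λ (a : ℤ₄) → all? λ (b : ℤ₄) →
  b ⊖ (x ⊖ a) ≟ a ⊖ (x ⊖ b))

⊖-⊖-neg : (x a c : ℤ₄) → (x ⊖ a) ⊖ - c ≡ x ⊖ (a ⊖ c)
⊖-⊖-neg = from-yes (all? λ (x : ℤ₄) → all? λ (a : ℤ₄) → all? λ (c : ℤ₄) →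
  (x ⊖ a) ⊖ - c ≟ x ⊖ (a ⊖ c))

⊖-cancelʳ : (a c : ℤ₄) → (a ⊖ c) ⊖ - c ≡ a
⊖-cancelʳ = from-yes (all? λ (a : ℤ₄) → all? λ (c : ℤ₄) → (a ⊖ c) ⊖ - c ≟ a)

neg-involutive : (c : ℤ₄) → - - c ≡ c
neg-involutive = from-yes (all? λ (c : ℤ₄) → - - c ≟ c)

even-reflection-distinguishes-0-1 : (ω : ℤ₄) → EvenZ ω →
                                    ¬ ((ω ⊖ (# 0) ≡ # 0) ⇔ (ω ⊖ (# 1) ≡ # 1))
even-reflection-distinguishes-0-1 fzero _ 0↔1 with Equivalence.to 0↔1 refl
... | ()
even-reflection-distinguishes-0-1 (fsuc (fsuc fzero)) _ 0↔1 with Equivalence.from 0↔1 refl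
... | ()
even-reflection-distinguishes-0-1 (fsuc fzero) ()
even-reflection-distinguishes-0-1 (fsuc (fsuc (fsuc fzero))) ()

parity-suc : (m : ℕ) → parity (suc m) ≡ parity m ⁻¹
parity-suc m = sym (⁻¹-selfInverse (suc-homo-⁻¹ m))

parity-odd : (m : ℕ) → m % 2 ≡ 1 → parity m ≡ 1ℙ
parity-odd zero            ()
parity-odd (suc zero)      _   = refl
parity-odd (suc (suc m))   odd = parity-odd m odd

fibreTransport : Parity → ℤ₄ → ℤ₄ → ℤ₄
fibreTransport 0ℙ ω a = a ⊖ ω
fibreTransport 1ℙ ω a = ω ⊖ a

fibreTransport-step : (p : Parity) (x ω a : ℤ₄) →
                      fibreTransport p ω (x ⊖ a) ≡ fibreTransport (p ⁻¹) (x ⊖ ω) a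
fibreTransport-step 0ℙ x ω a = ⊖-rightComm x a ω
fibreTransport-step 1ℙ x ω a = ⊖-⊖-exchange x a ω

signed : Bool → ℤ₄ → ℤ₄
signed false c = c
signed true  c = - c

signed-not : (j : Bool) (c : ℤ₄) → signed (not j) c ≡ - signed j c
signed-not false c = refl
signed-not true  c = sym (neg-involutive c)

module CrossCoverℤ₄ {n : ℕ} (M : PreManiplex n) (w : Fin n → Flag M → ℤ₄) where

  open CrossCover M w public

  proj₂-walkEnd : (u : Flag M) (a : ℤ₄) (cs : List (Fin n)) →
    proj₂ (walkEnd W (u , a) cs) ≡ fibreTransport (parity (length cs)) (walkWeight M w u cs) a
  proj₂-walkEnd u a []       = sym (⊖-identityʳ a)
  proj₂-walkEnd u a (c ∷ cs) = begin
    proj₂ (walkEnd W (r M c u , w c u ⊖ a) cs)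
      ≡⟨ proj₂-walkEnd (r M c u) (w c u ⊖ a) cs ⟩
    fibreTransport (parity (length cs)) ω′ (w c u ⊖ a)
      ≡⟨ fibreTransport-step (parity (length cs)) (w c u) ω′ a ⟩
    fibreTransport (parity (length cs) ⁻¹) (w c u ⊖ ω′) a
      ≡⟨ cong (λ p → fibreTransport p (w c u ⊖ ω′) a) (sym (parity-suc (length cs))) ⟩
    fibreTransport (parity (suc (length cs))) (w c u ⊖ ω′) a
      ∎
    where
    open ≡-Reasoning
    ω′ = walkWeight M w (r M c u) cs

  module ClosedOddWalk {u : Flag M} (cs : List (Fin n))
                       (closed : walkEnd M u cs ≡ u) (odd : length cs % 2 ≡ 1) where

    ω : ℤ₄
    ω = walkWeight M w u cs

    walkEnd-reflects : (a : ℤ₄) → walkEnd W (u , a) cs ≡ (u , ω ⊖ a)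
    walkEnd-reflects a = cong₂ _,_
      (trans (proj₁-walkEnd u a cs) closed)
      (trans (proj₂-walkEnd u a cs) (cong (λ p → fibreTransport p ω a) (parity-odd (length cs) odd)))

    to-reflection : (Ψ : Aut W) {a b : ℤ₄} → to Ψ (u , a) ≡ (u , b) →
                    to Ψ (u , ω ⊖ a) ≡ (u , ω ⊖ b)
    to-reflection Ψ {a} {b} eq = begin
      to Ψ (u , ω ⊖ a)            ≡⟨ cong (to Ψ) (sym (walkEnd-reflects a)) ⟩
      to Ψ (walkEnd W (u , a) cs) ≡⟨ to-walkEnd Ψ (u , a) cs ⟩
      walkEnd W (to Ψ (u , a)) cs ≡⟨ cong (λ y → walkEnd W y cs) eq ⟩
      walkEnd W (u , b) cs        ≡⟨ walkEnd-reflects b ⟩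
      (u , ω ⊖ b)                 ∎
      where open ≡-Reasoning

    to-preserves-reflection-fixed : (Ψ : Aut W) {a b : ℤ₄} → to Ψ (u , a) ≡ (u , b) →
                                    (ω ⊖ a ≡ a) ⇔ (ω ⊖ b ≡ b)
    to-preserves-reflection-fixed Ψ eq = mk⇔
      (λ a-fixed → cong proj₂
         (trans (sym (to-reflection Ψ eq)) (trans (cong (λ c → to Ψ (u , c)) a-fixed) eq)))
      (λ b-fixed → cong proj₂
         (to-injective Ψ (trans (to-reflection Ψ eq) (trans (cong (u ,_) b-fixed) (sym eq)))))

    not-SameOrbit-0-1 : EvenZ ω → ¬ SameOrbit W (u , # 0) (u , # 1)
    not-SameOrbit-0-1 even (Ψ , eq) =
      even-reflection-distinguishes-0-1 ω even (to-preserves-reflection-fixed Ψ eq)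

  shiftBy : ℤ₄ → Flag W → Flag W
  shiftBy c (x , a) = x , a ⊖ c

  shiftBy-cancelˡ : (c : ℤ₄) (y : Flag W) → shiftBy (- c) (shiftBy c y) ≡ y
  shiftBy-cancelˡ c (x , a) = cong (x ,_) (⊖-cancelʳ a c)

  shiftBy-cancelʳ : (c : ℤ₄) (y : Flag W) → shiftBy c (shiftBy (- c) y) ≡ y
  shiftBy-cancelʳ c y = trans (cong (λ s → shiftBy s (shiftBy (- c) y)) (sym (neg-involutive c)))
                              (shiftBy-cancelˡ (- c) y)

  r-shiftBy : (i : Fin n) (c : ℤ₄) (y : Flag W) → r W i (shiftBy c y) ≡ shiftBy (- c) (r W i y)
  r-shiftBy i c (x , a) = cong (r M i x ,_) (sym (⊖-⊖-neg (w i x) a c))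

  -- Since 2 = -2 in ℤ₄, r-shiftBy makes this shift commute with every r i.
  halfTurn : Aut W
  halfTurn = record
    { to       = shiftBy (# 2)
    ; from     = shiftBy (# 2)
    ; to-from  = shiftBy-cancelˡ (# 2)
    ; from-to  = shiftBy-cancelˡ (# 2)
    ; preserve = λ i y → sym (r-shiftBy i (# 2) y) }

  fibre-representatives : (u : Flag M) (a : ℤ₄) →
                          SameOrbit W (u , # 0) (u , a) ⊎ SameOrbit W (u , # 1) (u , a)
  fibre-representatives u fzero                      = inj₁ (SameOrbit-refl _)
  fibre-representatives u (fsuc fzero)               = inj₂ (SameOrbit-refl _)
  fibre-representatives u (fsuc (fsuc fzero))        = inj₁ (halfTurn , refl)
  fibre-representatives u (fsuc (fsuc (fsuc fzero))) = inj₂ (halfTurn , refl)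

  twoOrbit : Regular M → Consistent M w →
             (u : Flag M) (cs : List (Fin n)) → walkEnd M u cs ≡ u → length cs % 2 ≡ 1 →
             EvenZ (walkWeight M w u cs) → TwoOrbit W
  twoOrbit regular consistent u cs closed odd even =
    (u , # 0) , (u , # 1) , ClosedOddWalk.not-SameOrbit-0-1 cs closed odd even , covered
    where
    covered : (x : Flag W) → SameOrbit W (u , # 0) x ⊎ SameOrbit W (u , # 1) x
    covered x with orbit-meets-fibre regular consistent u x
    ... | a , a∼x = ⊎-map (λ h → SameOrbit-trans h a∼x) (λ h → SameOrbit-trans h a∼x)
                          (fibre-representatives u a)

  twistedShift : ℤ₄ → Aut (doubleCover W)
  twistedShift c = record
    { to       = λ (y , j) → shiftBy (signed j c) y , j
    ; from     = λ (y , j) → shiftBy (- signed j c) y , j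
    ; to-from  = λ (y , j) → cong (_, j) (shiftBy-cancelʳ (signed j c) y)
    ; from-to  = λ (y , j) → cong (_, j) (shiftBy-cancelˡ (signed j c) y)
    ; preserve = λ i (y , j) → cong (_, not j)
        (trans (cong (λ s → shiftBy s (r W i y)) (signed-not j c))
               (sym (r-shiftBy i (signed j c) y))) }

  twistedShift-unexpected : (c : ℤ₄) → - c ≢ c → Flag M → ¬ Expected W (twistedShift c)
  twistedShift-unexpected c -c≢c u expected = -c≢c (begin
    - c    ≡⟨ cong proj₂ (Expected⇒sheet-independent W (twistedShift c) expected (u , # 0)) ⟩
    - - c  ≡⟨ neg-involutive c ⟩
    c      ∎)
    where open ≡-Reasoning

  unstable : Flag M → Unstable W
  unstable u = twistedShift (# 1) , twistedShift-unexpected (# 1) (λ ()) u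

lemma5p8 : ∀ {n} (M : PreManiplex n) → IsManiplex M →
           (w : Fin n → Flag M → Fin 4) → IsWeight M w →
           ProperPair M w →
           IsManiplex (crossCover M w) × TwoOrbit (crossCover M w) × Unstable (crossCover M w)
lemma5p8 M _ w _ (regular , (u , cs , closed , odd , even) , (isManiplex , _) , consistent) =
  isManiplex , twoOrbit regular consistent u cs closed odd even , unstable u
  where open CrossCoverℤ₄ M w
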